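{- Let $k\ge1$. For $1\le s\le k$ and $n,j\ge1$, let $BL'_{k,s}(n,j)$ (resp. $BL''_{k,s}(n,j-1)$) be the number of overpartitions $\lambda$ of $n$ in $\mathcal{BL}_k$ such that $\ell(\lambda)\equiv s\pmod k$, $\ell_o(\lambda)=j$ (resp. $\ell_o(\lambda)=j-1$) and the smallest part of $\lambda$ is $\overline1$ (resp. $1$), and let $D_{k,s}(n,j)$ be the number of partitions of $n$ into $j$ distinct parts, each congruent to $s$ modulo $k$. Then \[ BL'_{k,s}(n,j)=BL''_{k,s}(n,j-1)=D_{k,s}(n,j). \]
   Context: Overpartitions here are non-increasing sequences of positive integers in which the last occurrence of each distinct part value may be overlined; a part $t$ or $\overline t$ has size $t$, written $|\cdot|=t$; an overpartition of $n$ has part sizes summing to $n$; $\ell(\lambda)$ is the number of parts and $\ell_o(\lambda)$ the number of overlined parts. An $L_k$-overpartition is an overpartition $\pi=(\pi_1,\ldots,\pi_\ell)$ such that whenever $\pi_i$ is overlined, $\ell-i\equiv 0\pmod k$. For $m\ge1$, $\mathcal{BL}_k(m)$ is the set of $L_k$-overpartitions $\lambda=(\lambda_1,\ldots,\lambda_m)$ with exactly $m$ parts such that $\lambda_m=\overline1$ or $1$, and for $1\le i<m$, $|\lambda_i|\le|\lambda_{i+1}|+1$, with strict inequality if $\lambda_i$ is non-overlined. $\mathcal{BL}_k=\bigcup_{m\ge1}\mathcal{BL}_k(m)$. -}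

module Defs where

open import Data.Nat using (ℕ; zero; suc; _+_; _≤_; _<_; NonZero)
open import Data.Nat.DivMod using (_%_)
open import Data.Nat.Divisibility using (_∣_)
open import Data.Bool using (Bool; true; false)
open import Data.Product using (Σ; _×_; _,_; proj₁)
open import Data.List using (List; []; _∷_; length; map)
open import Data.Nat.ListAction using (sum)
open import Data.List.Relation.Unary.Unique.Propositional using (Unique)
open import Data.List.Membership.Propositional using (_∈_)
open import Data.Unit using (⊤)
open import Data.Empty using (⊥)
open import Relation.Binary.PropositionalEquality using (_≡_)
open import Function.Bundles using (_⇔_)

-- A part is (size , overlined?).
Part : Set
Part = ℕ × Bool

size : Part → ℕ
size = proj₁

OverPtn : Set
OverPtn = List Part

AllPos : OverPtn → Set
AllPos []            = ⊤
AllPos ((t , _) ∷ r) = 1 ≤ t × AllPos r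

-- consecutive-pair conditions: non-increasing, and an overlined part must be
-- the last occurrence of its value (the next part, if any, is strictly smaller)
OverPtnShape : OverPtn → Set
OverPtnShape []                               = ⊤
OverPtnShape (_ ∷ [])                         = ⊤
OverPtnShape ((t , false) ∷ (u , o) ∷ r) = u ≤ t × OverPtnShape ((u , o) ∷ r)
OverPtnShape ((t , true)  ∷ (u , o) ∷ r) = u < t × OverPtnShape ((u , o) ∷ r)

IsOverpartition : OverPtn → Set
IsOverpartition π = AllPos π × OverPtnShape π

weight : OverPtn → ℕ
weight π = sum (map size π)

numOver : OverPtn → ℕ
numOver []                = 0
numOver ((_ , true)  ∷ r) = suc (numOver r)
numOver ((_ , false) ∷ r) = numOver r

-- L_k condition: if π_i is overlined then k ∣ ℓ − i (the number of parts after π_i)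
LkCond : ℕ → OverPtn → Set
LkCond k []                = ⊤
LkCond k ((_ , true)  ∷ r) = k ∣ length r × LkCond k r
LkCond k ((_ , false) ∷ r) = LkCond k r

IsLk : ℕ → OverPtn → Set
IsLk k π = IsOverpartition π × LkCond k π

LastIs : Part → OverPtn → Set
LastIs p []            = ⊥
LastIs p (q ∷ [])      = q ≡ p
LastIs p (_ ∷ q ∷ r)   = LastIs p (q ∷ r)

BLChain : OverPtn → Set
BLChain []                               = ⊤
BLChain (_ ∷ [])                         = ⊤
BLChain ((t , true)  ∷ (u , o) ∷ r) = t ≤ u + 1 × BLChain ((u , o) ∷ r)
BLChain ((t , false) ∷ (u , o) ∷ r) = t < u + 1 × BLChain ((u , o) ∷ r)

LastSizeOne : OverPtn → Set
LastSizeOne π = Σ Bool λ b → LastIs (1 , b) π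

-- λ ∈ BL_k  (= ⋃_{m ≥ 1} BL_k(m); m = ℓ(λ) ≥ 1 is forced by LastSizeOne)
IsBL : ℕ → OverPtn → Set
IsBL k π = IsLk k π × LastSizeOne π × BLChain π

BL′Set : (k s n j : ℕ) → .{{NonZero k}} → OverPtn → Set
BL′Set k s n j π =
  IsBL k π × weight π ≡ n × length π % k ≡ s % k × numOver π ≡ j × LastIs (1 , true) π

BL″Set : (k s n i : ℕ) → .{{NonZero k}} → OverPtn → Set
BL″Set k s n i π =
  IsBL k π × weight π ≡ n × length π % k ≡ s % k × numOver π ≡ i × LastIs (1 , false) π

-- partitions into distinct parts: strictly decreasing lists of positive naturals
StrictDec : List ℕ → Set
StrictDec []          = ⊤
StrictDec (_ ∷ [])    = ⊤
StrictDec (a ∷ b ∷ r) = b < a × StrictDec (b ∷ r)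

AllPosℕ : List ℕ → Set
AllPosℕ []      = ⊤
AllPosℕ (a ∷ r) = 1 ≤ a × AllPosℕ r

AllCong : (k s : ℕ) → .{{NonZero k}} → List ℕ → Set
AllCong k s []      = ⊤
AllCong k s (a ∷ r) = a % k ≡ s % k × AllCong k s r

DSet : (k s n j : ℕ) → .{{NonZero k}} → List ℕ → Set
DSet k s n j μ = AllPosℕ μ × StrictDec μ × sum μ ≡ n × length μ ≡ j × AllCong k s μ

HasCount : {A : Set} → (A → Set) → ℕ → Set
HasCount {A} P c =
  Σ (List A) λ xs → Unique xs × ((x : A) → (x ∈ xs ⇔ P x)) × length xs ≡ c

-- In a BL′-overpartition the shape and chain conditions force every part to be the number of
-- overlined parts from it to the end, so the overpartition is determined by its word of overlines,
-- which ends in a bar.  The positions i of the overlined parts form a partition of |π| = Σ i into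
-- ℓ_o(π) distinct parts, and the L_k condition k ∣ ℓ − i says that they are all congruent to the
-- largest one, ℓ ≡ s (mod k); conversely each such partition is the set of overline positions of
-- its indicator word.
-- Unbarring the final 1̄ is a bijection from BL′ onto BL″ that lowers ℓ_o by one.

module Submission where

open import Defs
open import Data.Bool using (Bool; true; false)
open import Data.Empty using (⊥-elim)
open import Data.List using (List; []; _∷_; _++_; _∷ʳ_; length; map; filter; replicate; last)
open import Data.List.Properties
  using (length-map; length-++; length-replicate; map-++; map-∘; map-id; map-id-local; ++-assoc; ++-identityʳ; ∷-injectiveˡ; ∷-injectiveʳ)
open import Data.List.Membership.Propositional using (_∈_)
open import Data.List.Membership.Propositional.Properties
  using (∈-map⁺; ∈-map⁻; ∈-++⁺ˡ; ∈-++⁺ʳ; ∈-++⁻; ∈-filter⁺; ∈-filter⁻)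
open import Data.List.Relation.Binary.Disjoint.Propositional using (Disjoint)
open import Data.List.Relation.Unary.All as All using (All; []; _∷_)
import Data.List.Relation.Unary.All.Properties as All
open import Data.List.Relation.Unary.AllPairs using ([]; _∷_)
open import Data.List.Relation.Unary.Any using (here)
open import Data.List.Relation.Unary.Unique.Propositional using (Unique)
import Data.List.Relation.Unary.Unique.Propositional.Properties as Unique
open import Data.Maybe using (just)
open import Data.Nat using (ℕ; zero; suc; _+_; _*_; _∸_; _≤_; _<_; z≤n; s≤s; z<s; NonZero; _≟_; _≤?_; _<?_)
open import Data.Nat.Properties
open import Algebra.Properties.CommutativeSemigroup +-commutativeSemigroup using (x∙yz≈y∙xz)
open import Data.Nat.DivMod using (_%_; _/_; m≡m%n+[m/n]*n; %-congˡ; %-remove-+ʳ)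
open import Data.Nat.Divisibility using (_∣_; divides; _∣0)
open import Data.Nat.ListAction using (sum)
open import Data.Nat.ListAction.Properties using (sum-++)
open import Data.Product using (Σ; _×_; _,_; proj₁; proj₂)
open import Data.Sum using (inj₁; inj₂)
open import Data.Unit using (tt)
open import Function using (_∘_)
open import Function.Bundles using (_⇔_; mk⇔; Equivalence)
open import Relation.Binary.PropositionalEquality
open import Relation.Nullary using (yes; no)
open import Relation.Nullary.Decidable using (_×-dec_)
open import Relation.Unary using (Decidable)

%≡⇒∣∸ : ∀ k .{{_ : NonZero k}} {m n} → n % k ≡ m % k → k ∣ m ∸ n
%≡⇒∣∸ k {m} {n} n≡m = divides (m / k ∸ n / k) (begin
  m ∸ n                                      ≡⟨ cong₂ _∸_ (m≡m%n+[m/n]*n m k) (m≡m%n+[m/n]*n n k) ⟩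
  (m % k + m / k * k) ∸ (n % k + n / k * k)  ≡⟨ cong (λ r → (r + m / k * k) ∸ (n % k + n / k * k)) (sym n≡m) ⟩
  (n % k + m / k * k) ∸ (n % k + n / k * k)  ≡⟨ [m+n]∸[m+o]≡n∸o (n % k) _ _ ⟩
  m / k * k ∸ n / k * k                      ≡⟨ *-distribʳ-∸ k (m / k) (n / k) ⟨
  (m / k ∸ n / k) * k                        ∎)
  where open ≡-Reasoning

∣∸⇒%≡ : ∀ k .{{_ : NonZero k}} {m n} → n ≤ m → k ∣ m ∸ n → n % k ≡ m % k
∣∸⇒%≡ k {m} {n} n≤m k∣m∸n =
  sym (trans (%-congˡ (sym (m+[n∸m]≡n n≤m))) (%-remove-+ʳ n k∣m∸n))

m<n≤m+1⇒1+m≡n : ∀ {m n} → m < n → n ≤ m + 1 → suc m ≡ n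
m<n≤m+1⇒1+m≡n {m} {n} m<n n≤m+1 = ≤-antisym m<n (subst (n ≤_) (+-comm m 1) n≤m+1)

m≤n<m+1⇒m≡n : ∀ {m n} → m ≤ n → n < m + 1 → m ≡ n
m≤n<m+1⇒m≡n {m} {n} m≤n n<m+1 = ≤-antisym m≤n (m<1+n⇒m≤n (subst (n <_) (+-comm m 1) n<m+1))

m<n⇒m+[1+[n∸1+m]]≡n : ∀ {m n} → m < n → m + suc (n ∸ suc m) ≡ n
m<n⇒m+[1+[n∸1+m]]≡n {m} {n} m<n = trans (+-suc m (n ∸ suc m)) (m+[n∸m]≡n m<n)

sum-map-suc : ∀ μ → sum (map suc μ) ≡ length μ + sum μ
sum-map-suc []      = refl
sum-map-suc (a ∷ μ) = cong suc (trans (cong (a +_) (sum-map-suc μ)) (x∙yz≈y∙xz a (length μ) (sum μ)))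

length-∷ʳ : {A : Set} (xs : List A) (x : A) → length (xs ∷ʳ x) ≡ suc (length xs)
length-∷ʳ xs x = trans (length-++ xs) (+-comm (length xs) 1)

last-∷ʳ : {A : Set} (xs : List A) (x : A) → last (xs ∷ʳ x) ≡ just x
last-∷ʳ []          _ = refl
last-∷ʳ (_ ∷ [])    _ = refl
last-∷ʳ (_ ∷ y ∷ xs) x = last-∷ʳ (y ∷ xs) x

-- Counting along bijections
record _↔ᵖ_ {A B : Set} (P : A → Set) (Q : B → Set) : Set where
  field
    to        : A → B
    from      : B → A
    to-pres   : ∀ {x} → P x → Q (to x)
    from-pres : ∀ {y} → Q y → P (from y)
    from∘to   : ∀ {x} → P x → from (to x) ≡ x
    to∘from   : ∀ {y} → Q y → to (from y) ≡ y

HasCount-↔ᵖ : {A B : Set} {P : A → Set} {Q : B → Set} {c : ℕ} →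
              P ↔ᵖ Q → HasCount P c → HasCount Q c
HasCount-↔ᵖ {Q = Q} P↔Q (xs , unique , ∈⇔P , length≡c) =
  map to xs , Unique.map⁻ (subst Unique (sym from∘to-xs) unique) , ∈⇔Q , trans (length-map to xs) length≡c
  where
  open _↔ᵖ_ P↔Q

  from∘to-xs : map from (map to xs) ≡ xs
  from∘to-xs = trans (sym (map-∘ xs))
    (map-id-local (All.map from∘to (All.tabulate (Equivalence.to (∈⇔P _)))))

  ∈⇔Q : ∀ y → y ∈ map to xs ⇔ Q y
  ∈⇔Q y = mk⇔ ∈⇒Q Q⇒∈
    where
    ∈⇒Q : y ∈ map to xs → Q y
    ∈⇒Q y∈ with ∈-map⁻ to y∈
    ... | x , x∈ , refl = to-pres (Equivalence.to (∈⇔P x) x∈)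

    Q⇒∈ : Q y → y ∈ map to xs
    Q⇒∈ q = subst (_∈ map to xs) (to∘from q) (∈-map⁺ to (Equivalence.from (∈⇔P _) (from-pres q)))

HasCount-filter : {A : Set} {P : A → Set} (P? : Decidable P) {xs : List A} →
                  Unique xs → (∀ {x} → P x → x ∈ xs) → HasCount P (length (filter P? xs))
HasCount-filter {P = P} P? {xs} unique complete =
  filter P? xs , Unique.filter⁺ P? unique , ∈⇔P , refl
  where
  ∈⇔P : ∀ x → x ∈ filter P? xs ⇔ P x
  ∈⇔P x = mk⇔ (proj₂ ∘ ∈-filter⁻ P? {xs = xs}) (λ px → ∈-filter⁺ P? (complete px) px)

-- Partitions into distinct parts
largestPart : List ℕ → ℕ
largestPart []      = 0
largestPart (a ∷ _) = a

largestPart≤sum : ∀ μ → largestPart μ ≤ sum μ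
largestPart≤sum []      = z≤n
largestPart≤sum (a ∷ μ) = m≤m+n a (sum μ)

StrictDec-tail : ∀ a μ → StrictDec (a ∷ μ) → StrictDec μ
StrictDec-tail a []      _         = tt
StrictDec-tail a (b ∷ μ) (_ , dec) = dec

largestPart-tail< : ∀ a μ → AllPosℕ (a ∷ μ) → StrictDec (a ∷ μ) → largestPart μ < a
largestPart-tail< a []      (1≤a , _) _         = 1≤a
largestPart-tail< a (b ∷ μ) _         (b<a , _) = b<a

StrictDec-map-suc : ∀ μ → StrictDec μ → StrictDec (map suc μ)
StrictDec-map-suc []          _           = tt
StrictDec-map-suc (_ ∷ [])    _           = tt
StrictDec-map-suc (a ∷ b ∷ μ) (b<a , dec) = s≤s b<a , StrictDec-map-suc (b ∷ μ) dec

StrictDec-∷ʳ : ∀ μ {a} → All (a <_) μ → StrictDec μ → StrictDec (μ ∷ʳ a)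
StrictDec-∷ʳ []          _           _           = tt
StrictDec-∷ʳ (_ ∷ [])    (a<b ∷ [])  _           = a<b , tt
StrictDec-∷ʳ (b ∷ c ∷ μ) (_ ∷ a<c∷μ) (c<b , dec) = c<b , StrictDec-∷ʳ (c ∷ μ) a<c∷μ dec

All⇒AllPosℕ : ∀ {μ} → All (1 ≤_) μ → AllPosℕ μ
All⇒AllPosℕ []           = tt
All⇒AllPosℕ (1≤a ∷ 1≤μ) = 1≤a , All⇒AllPosℕ 1≤μ

module _ (k s : ℕ) .{{_ : NonZero k}} where

  All⇒AllCong : ∀ {μ} → All (λ a → a % k ≡ s % k) μ → AllCong k s μ
  All⇒AllCong []       = tt
  All⇒AllCong (a ∷ as) = a , All⇒AllCong as

  AllCong⇒All : ∀ μ → AllCong k s μ → All (λ a → a % k ≡ s % k) μ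
  AllCong⇒All []      _        = []
  AllCong⇒All (_ ∷ μ) (a , as) = a ∷ AllCong⇒All μ as

  AllCong⇒∣∸ : ∀ a μ → AllCong k s (a ∷ μ) → All (λ i → k ∣ a ∸ i) (a ∷ μ)
  AllCong⇒∣∸ a μ ≡s = All.map (λ i≡s → %≡⇒∣∸ k (trans i≡s (sym (proj₁ ≡s)))) (AllCong⇒All (a ∷ μ) ≡s)

decreasingListsUpTo : ℕ → List (List ℕ)
decreasingListsUpTo zero    = [] ∷ []
decreasingListsUpTo (suc B) = decreasingListsUpTo B ++ map (suc B ∷_) (decreasingListsUpTo B)

largestPart-decreasingListsUpTo : ∀ B {μ} → μ ∈ decreasingListsUpTo B → largestPart μ ≤ B
largestPart-decreasingListsUpTo zero    (here refl) = z≤n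
largestPart-decreasingListsUpTo (suc B) μ∈ with ∈-++⁻ (decreasingListsUpTo B) μ∈
... | inj₁ μ∈′ = m≤n⇒m≤1+n (largestPart-decreasingListsUpTo B μ∈′)
... | inj₂ μ∈′ with ∈-map⁻ (suc B ∷_) μ∈′
...   | _ , _ , refl = ≤-refl

unique-decreasingListsUpTo : ∀ B → Unique (decreasingListsUpTo B)
unique-decreasingListsUpTo zero    = [] ∷ []
unique-decreasingListsUpTo (suc B) =
  Unique.++⁺ (unique-decreasingListsUpTo B) (Unique.map⁺ ∷-injectiveʳ (unique-decreasingListsUpTo B)) disjoint
  where
  disjoint : Disjoint (decreasingListsUpTo B) (map (suc B ∷_) (decreasingListsUpTo B))
  disjoint (μ∈ , μ∈′) with ∈-map⁻ (suc B ∷_) μ∈′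
  ... | _ , _ , refl = 1+n≰n (largestPart-decreasingListsUpTo B μ∈)

∈-decreasingListsUpTo : ∀ B μ → AllPosℕ μ → StrictDec μ → largestPart μ ≤ B → μ ∈ decreasingListsUpTo B
∈-decreasingListsUpTo zero    []      _           _   _  = here refl
∈-decreasingListsUpTo (suc B) []      pos         dec _  = ∈-++⁺ˡ (∈-decreasingListsUpTo B [] pos dec z≤n)
∈-decreasingListsUpTo zero    (a ∷ μ) (1≤a , _)   _   a≤0 = ⊥-elim (1+n≰n (≤-trans 1≤a a≤0))
∈-decreasingListsUpTo (suc B) (a ∷ μ) pos@(_ , pos′) dec a≤1+B with a ≤? B
... | yes a≤B = ∈-++⁺ˡ (∈-decreasingListsUpTo B (a ∷ μ) pos dec a≤B)
... | no  a≰B with ≤-antisym a≤1+B (≰⇒> a≰B)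
...   | refl = ∈-++⁺ʳ (decreasingListsUpTo B) (∈-map⁺ (suc B ∷_)
                 (∈-decreasingListsUpTo B μ pos′ (StrictDec-tail a μ dec) (≤-pred (largestPart-tail< a μ pos dec))))

AllPosℕ? : Decidable AllPosℕ
AllPosℕ? []      = yes tt
AllPosℕ? (a ∷ μ) = (1 ≤? a) ×-dec AllPosℕ? μ

StrictDec? : Decidable StrictDec
StrictDec? []          = yes tt
StrictDec? (_ ∷ [])    = yes tt
StrictDec? (a ∷ b ∷ μ) = (b <? a) ×-dec StrictDec? (b ∷ μ)

AllCong? : ∀ k s .{{_ : NonZero k}} → Decidable (AllCong k s)
AllCong? k s []      = yes tt
AllCong? k s (a ∷ μ) = (a % k ≟ s % k) ×-dec AllCong? k s μ

DSet? : ∀ k s n j .{{_ : NonZero k}} → Decidable (DSet k s n j)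
DSet? k s n j μ =
  AllPosℕ? μ ×-dec StrictDec? μ ×-dec (sum μ ≟ n) ×-dec (length μ ≟ j) ×-dec AllCong? k s μ

DSet-count : ∀ k s n j .{{_ : NonZero k}} →
             HasCount (DSet k s n j) (length (filter (DSet? k s n j) (decreasingListsUpTo n)))
DSet-count k s n j = HasCount-filter (DSet? k s n j) (unique-decreasingListsUpTo n) complete
  where
  complete : ∀ {μ} → DSet k s n j μ → μ ∈ decreasingListsUpTo n
  complete {μ} (pos , dec , sum≡n , _) =
    ∈-decreasingListsUpTo n μ pos dec (subst (largestPart μ ≤_) sum≡n (largestPart≤sum μ))

-- Overline words
trueCount : List Bool → ℕ
trueCount []          = 0
trueCount (true ∷ w)  = suc (trueCount w)
trueCount (false ∷ w) = trueCount w

1≤trueCount : ∀ w → last w ≡ just true → 1 ≤ trueCount w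
1≤trueCount (true ∷ _)      _ = s≤s z≤n
1≤trueCount (false ∷ c ∷ w) e = 1≤trueCount (c ∷ w) e

fromWord : List Bool → OverPtn
fromWord []      = []
fromWord (b ∷ w) = (trueCount (b ∷ w) , b) ∷ fromWord w

overlines : OverPtn → List Bool
overlines = map proj₂

-- the positions of true in w, numbered from 1, in decreasing order
positions : List Bool → List ℕ
positions []          = []
positions (true ∷ w)  = map suc (positions w) ∷ʳ 1
positions (false ∷ w) = map suc (positions w)

indicator : List ℕ → List Bool
indicator []      = []
indicator (a ∷ μ) = indicator μ ++ replicate (a ∸ suc (largestPart μ)) false ∷ʳ true

length-fromWord : ∀ w → length (fromWord w) ≡ length w
length-fromWord []      = refl
length-fromWord (_ ∷ w) = cong suc (length-fromWord w)

overlines-fromWord : ∀ w → overlines (fromWord w) ≡ w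
overlines-fromWord []      = refl
overlines-fromWord (b ∷ w) = cong (b ∷_) (overlines-fromWord w)

numOver-fromWord : ∀ w → numOver (fromWord w) ≡ trueCount w
numOver-fromWord []          = refl
numOver-fromWord (true ∷ w)  = cong suc (numOver-fromWord w)
numOver-fromWord (false ∷ w) = numOver-fromWord w

length-positions : ∀ w → length (positions w) ≡ trueCount w
length-positions []          = refl
length-positions (true ∷ w)  =
  trans (length-∷ʳ (map suc (positions w)) 1) (cong suc (trans (length-map suc (positions w)) (length-positions w)))
length-positions (false ∷ w) = trans (length-map suc (positions w)) (length-positions w)

weight-fromWord : ∀ w → weight (fromWord w) ≡ sum (positions w)
weight-fromWord []          = refl
weight-fromWord (true ∷ w)  = begin
  suc (trueCount w + weight (fromWord w))  ≡⟨ cong suc (cong₂ _+_ (sym (length-positions w)) (weight-fromWord w)) ⟩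
  suc (length P + sum P)                   ≡⟨ cong suc (sum-map-suc P) ⟨
  suc (sum (map suc P))                    ≡⟨ +-comm 1 _ ⟩
  sum (map suc P) + 1                      ≡⟨ sum-++ (map suc P) (1 ∷ []) ⟨
  sum (map suc P ∷ʳ 1)                     ∎
  where
  open ≡-Reasoning
  P : List ℕ
  P = positions w
weight-fromWord (false ∷ w) = trans (cong₂ _+_ (sym (length-positions w)) (weight-fromWord w)) (sym (sum-map-suc (positions w)))

AllPos-fromWord : ∀ w → last w ≡ just true → AllPos (fromWord w)
AllPos-fromWord (b ∷ [])    e = 1≤trueCount (b ∷ []) e , tt
AllPos-fromWord (b ∷ c ∷ w) e = 1≤trueCount (b ∷ c ∷ w) e , AllPos-fromWord (c ∷ w) e

OverPtnShape-fromWord : ∀ w → OverPtnShape (fromWord w)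
OverPtnShape-fromWord []              = tt
OverPtnShape-fromWord (_ ∷ [])        = tt
OverPtnShape-fromWord (true ∷ c ∷ w)  = ≤-refl , OverPtnShape-fromWord (c ∷ w)
OverPtnShape-fromWord (false ∷ c ∷ w) = ≤-refl , OverPtnShape-fromWord (c ∷ w)

BLChain-fromWord : ∀ w → BLChain (fromWord w)
BLChain-fromWord []              = tt
BLChain-fromWord (_ ∷ [])        = tt
BLChain-fromWord (true ∷ c ∷ w)  = m<m+n _ z<s , BLChain-fromWord (c ∷ w)
BLChain-fromWord (false ∷ c ∷ w) = m<m+n _ z<s , BLChain-fromWord (c ∷ w)

LastIs-fromWord : ∀ w → last w ≡ just true → LastIs (1 , true) (fromWord w)
LastIs-fromWord (true ∷ [])  _ = refl
LastIs-fromWord (_ ∷ c ∷ w)  e = LastIs-fromWord (c ∷ w) e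

last-overlines : ∀ π → LastIs (1 , true) π → last (overlines π) ≡ just true
last-overlines (_ ∷ [])    refl = refl
last-overlines (_ ∷ q ∷ π) l    = last-overlines (q ∷ π) l

-- The shape and chain conditions force each part to exceed the next one by exactly its own overline.
trueCount-overlines : ∀ p π → OverPtnShape (p ∷ π) → BLChain (p ∷ π) → LastIs (1 , true) (p ∷ π) →
                      trueCount (overlines (p ∷ π)) ≡ size p
trueCount-overlines _          []      _             _               refl = refl
trueCount-overlines (t , true)  (q ∷ π) (q<t , shape) (t≤q+1 , chain) l    =
  trans (cong suc (trueCount-overlines q π shape chain l)) (m<n≤m+1⇒1+m≡n q<t t≤q+1)
trueCount-overlines (t , false) (q ∷ π) (q≤t , shape) (t<q+1 , chain) l    =
  trans (trueCount-overlines q π shape chain l) (m≤n<m+1⇒m≡n q≤t t<q+1)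

fromWord-overlines : ∀ π → OverPtnShape π → BLChain π → LastIs (1 , true) π → fromWord (overlines π) ≡ π
fromWord-overlines (_ ∷ []) _ _ refl = refl
fromWord-overlines (p@(_ , true) ∷ q ∷ π) shape@(_ , shape′) chain@(_ , chain′) l =
  cong₂ (λ m ρ → (m , true) ∷ ρ) (trueCount-overlines p (q ∷ π) shape chain l) (fromWord-overlines (q ∷ π) shape′ chain′ l)
fromWord-overlines (p@(_ , false) ∷ q ∷ π) shape@(_ , shape′) chain@(_ , chain′) l =
  cong₂ (λ m ρ → (m , false) ∷ ρ) (trueCount-overlines p (q ∷ π) shape chain l) (fromWord-overlines (q ∷ π) shape′ chain′ l)

positions-positive : ∀ w → All (1 ≤_) (positions w)
positions-positive []          = []
positions-positive (true ∷ w)  = All.∷ʳ⁺ (All.map⁺ (All.map (λ _ → s≤s z≤n) (positions-positive w))) ≤-refl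
positions-positive (false ∷ w) = All.map⁺ (All.map (λ _ → s≤s z≤n) (positions-positive w))

positions-≤length : ∀ w → All (_≤ length w) (positions w)
positions-≤length []          = []
positions-≤length (true ∷ w)  = All.∷ʳ⁺ (All.map⁺ (All.map s≤s (positions-≤length w))) (s≤s z≤n)
positions-≤length (false ∷ w) = All.map⁺ (All.map s≤s (positions-≤length w))

positions-strictDec : ∀ w → StrictDec (positions w)
positions-strictDec []          = tt
positions-strictDec (true ∷ w)  =
  StrictDec-∷ʳ (map suc (positions w)) (All.map⁺ (All.map s≤s (positions-positive w)))
    (StrictDec-map-suc (positions w) (positions-strictDec w))
positions-strictDec (false ∷ w) = StrictDec-map-suc (positions w) (positions-strictDec w)

-- The part at position i of fromWord w is followed by length w ∸ i parts.
module _ (k : ℕ) where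

  LkCond-fromWord⁻ : ∀ w → LkCond k (fromWord w) → All (λ i → k ∣ length w ∸ i) (positions w)
  LkCond-fromWord⁻ []          _          = []
  LkCond-fromWord⁻ (true ∷ w)  (k∣ℓ , lk) =
    All.∷ʳ⁺ (All.map⁺ (LkCond-fromWord⁻ w lk)) (subst (k ∣_) (length-fromWord w) k∣ℓ)
  LkCond-fromWord⁻ (false ∷ w) lk          = All.map⁺ (LkCond-fromWord⁻ w lk)

  LkCond-fromWord⁺ : ∀ w → All (λ i → k ∣ length w ∸ i) (positions w) → LkCond k (fromWord w)
  LkCond-fromWord⁺ []          _  = tt
  LkCond-fromWord⁺ (true ∷ w)  lk with All.∷ʳ⁻ lk
  ... | lk′ , k∣ℓ = subst (k ∣_) (sym (length-fromWord w)) k∣ℓ , LkCond-fromWord⁺ w (All.map⁻ lk′)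
  LkCond-fromWord⁺ (false ∷ w) lk = LkCond-fromWord⁺ w (All.map⁻ lk)

  IsBL-fromWord : ∀ w → last w ≡ just true → All (λ i → k ∣ length w ∸ i) (positions w) → IsBL k (fromWord w)
  IsBL-fromWord w lastTrue lk =
    ((AllPos-fromWord w lastTrue , OverPtnShape-fromWord w) , LkCond-fromWord⁺ w lk) ,
    (true , LastIs-fromWord w lastTrue) , BLChain-fromWord w

positions-++ : ∀ u v → positions (u ++ v) ≡ map (length u +_) (positions v) ++ positions u
positions-++ []          v = sym (trans (++-identityʳ _) (map-id (positions v)))
positions-++ (true ∷ u)  v = begin
  map suc (positions (u ++ v)) ∷ʳ 1                              ≡⟨ cong (λ ν → map suc ν ∷ʳ 1) (positions-++ u v) ⟩
  map suc (map (length u +_) (positions v) ++ positions u) ∷ʳ 1  ≡⟨ cong (_∷ʳ 1) (map-++ suc (map (length u +_) (positions v)) (positions u)) ⟩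
  (map suc (map (length u +_) (positions v)) ++ map suc (positions u)) ∷ʳ 1
                                                                  ≡⟨ ++-assoc (map suc (map (length u +_) (positions v))) _ _ ⟩
  map suc (map (length u +_) (positions v)) ++ (map suc (positions u) ∷ʳ 1)
                                                                  ≡⟨ cong (_++ (map suc (positions u) ∷ʳ 1)) (map-∘ (positions v)) ⟨
  map (suc (length u) +_) (positions v) ++ (map suc (positions u) ∷ʳ 1) ∎
  where open ≡-Reasoning
positions-++ (false ∷ u) v = begin
  map suc (positions (u ++ v))                                    ≡⟨ cong (map suc) (positions-++ u v) ⟩
  map suc (map (length u +_) (positions v) ++ positions u)        ≡⟨ map-++ suc (map (length u +_) (positions v)) (positions u) ⟩
  map suc (map (length u +_) (positions v)) ++ map suc (positions u)
                                                                  ≡⟨ cong (_++ map suc (positions u)) (map-∘ (positions v)) ⟨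
  map (suc (length u) +_) (positions v) ++ map suc (positions u) ∎
  where open ≡-Reasoning

positions-gap : ∀ r → positions (replicate r false ∷ʳ true) ≡ suc r ∷ []
positions-gap zero    = refl
positions-gap (suc r) = cong (map suc) (positions-gap r)

length-indicator : ∀ μ → AllPosℕ μ → StrictDec μ → length (indicator μ) ≡ largestPart μ
length-indicator []      _   _   = refl
length-indicator (a ∷ μ) pos dec = begin
  length (indicator μ ++ replicate r false ∷ʳ true)               ≡⟨ length-++ (indicator μ) ⟩
  length (indicator μ) + length (replicate r false ∷ʳ true)      ≡⟨ cong₂ _+_ (length-indicator μ (proj₂ pos) (StrictDec-tail a μ dec)) (trans (length-∷ʳ (replicate r false) true) (cong suc (length-replicate r))) ⟩
  largestPart μ + suc r                                           ≡⟨ m<n⇒m+[1+[n∸1+m]]≡n (largestPart-tail< a μ pos dec) ⟩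
  a                                                               ∎
  where
  open ≡-Reasoning
  r : ℕ
  r = a ∸ suc (largestPart μ)

positions-indicator : ∀ μ → AllPosℕ μ → StrictDec μ → positions (indicator μ) ≡ μ
positions-indicator []      _   _   = refl
positions-indicator (a ∷ μ) pos dec = begin
  positions (indicator μ ++ replicate r false ∷ʳ true)
    ≡⟨ positions-++ (indicator μ) (replicate r false ∷ʳ true) ⟩
  map (length (indicator μ) +_) (positions (replicate r false ∷ʳ true)) ++ positions (indicator μ)
    ≡⟨ cong₂ (λ ν ρ → map (length (indicator μ) +_) ν ++ ρ) (positions-gap r) (positions-indicator μ pos′ dec′) ⟩
  length (indicator μ) + suc r ∷ μ
    ≡⟨ cong (λ m → m + suc r ∷ μ) (length-indicator μ pos′ dec′) ⟩
  largestPart μ + suc r ∷ μ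
    ≡⟨ cong (_∷ μ) (m<n⇒m+[1+[n∸1+m]]≡n (largestPart-tail< a μ pos dec)) ⟩
  a ∷ μ ∎
  where
  open ≡-Reasoning
  r : ℕ
  r = a ∸ suc (largestPart μ)
  pos′ : AllPosℕ μ
  pos′ = proj₂ pos
  dec′ : StrictDec μ
  dec′ = StrictDec-tail a μ dec

last-indicator : ∀ a μ → last (indicator (a ∷ μ)) ≡ just true
last-indicator a μ =
  trans (cong last (sym (++-assoc (indicator μ) (replicate (a ∸ suc (largestPart μ)) false) (true ∷ []))))
        (last-∷ʳ (indicator μ ++ replicate (a ∸ suc (largestPart μ)) false) true)

indicator-∷ʳ1 : ∀ μ → indicator (map suc μ ∷ʳ 1) ≡ true ∷ indicator μ
indicator-∷ʳ1 []          = refl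
indicator-∷ʳ1 (a ∷ [])    = refl
indicator-∷ʳ1 (a ∷ b ∷ μ) = cong (_++ replicate (a ∸ suc b) false ∷ʳ true) (indicator-∷ʳ1 (b ∷ μ))

indicator-map-suc : ∀ μ → All (1 ≤_) μ → 1 ≤ length μ → indicator (map suc μ) ≡ false ∷ indicator μ
indicator-map-suc (suc _ ∷ []) _           _ = refl
indicator-map-suc (a ∷ b ∷ μ)  (_ ∷ 1≤b∷μ) _ =
  cong (_++ replicate (a ∸ suc b) false ∷ʳ true) (indicator-map-suc (b ∷ μ) 1≤b∷μ (s≤s z≤n))

indicator-positions : ∀ w → last w ≡ just true → indicator (positions w) ≡ w
indicator-positions (true ∷ [])      _ = refl
indicator-positions (true ∷ c ∷ w)   e =
  trans (indicator-∷ʳ1 (positions (c ∷ w))) (cong (true ∷_) (indicator-positions (c ∷ w) e))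
indicator-positions (false ∷ c ∷ w)  e =
  trans (indicator-map-suc (positions (c ∷ w)) (positions-positive (c ∷ w)) nonempty)
        (cong (false ∷_) (indicator-positions (c ∷ w) e))
  where
  nonempty : 1 ≤ length (positions (c ∷ w))
  nonempty = subst (1 ≤_) (sym (length-positions (c ∷ w))) (1≤trueCount (c ∷ w) e)

-- Distinct partitions and BL′-overpartitions
module _ (k : ℕ) .{{_ : NonZero k}} (s n j : ℕ) (1≤j : 1 ≤ j) where

  DSet⇒BL′Set : ∀ {μ} → DSet k s n j μ → BL′Set k s n j (fromWord (indicator μ))
  DSet⇒BL′Set {[]}    (_ , _ , _ , refl , _) = ⊥-elim (1+n≰n 1≤j)
  DSet⇒BL′Set {a ∷ μ} (pos , dec , sum≡n , length≡j , ≡s) =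
    IsBL-fromWord k w lastTrue lk ,
    trans (weight-fromWord w) (trans (cong sum positions≡) sum≡n) ,
    trans (cong (_% k) (trans (length-fromWord w) length≡a)) (proj₁ ≡s) ,
    trans (numOver-fromWord w) (trans (sym (length-positions w)) (trans (cong length positions≡) length≡j)) ,
    LastIs-fromWord w lastTrue
    where
    w : List Bool
    w = indicator (a ∷ μ)
    positions≡ : positions w ≡ a ∷ μ
    positions≡ = positions-indicator (a ∷ μ) pos dec
    length≡a : length w ≡ a
    length≡a = length-indicator (a ∷ μ) pos dec
    lastTrue : last w ≡ just true
    lastTrue = last-indicator a μ
    lk : All (λ i → k ∣ length w ∸ i) (positions w)
    lk = subst₂ (λ m ν → All (λ i → k ∣ m ∸ i) ν) (sym length≡a) (sym positions≡) (AllCong⇒∣∸ k s a μ ≡s)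

  BL′Set⇒DSet : ∀ {π} → BL′Set k s n j π → DSet k s n j (positions (overlines π))
  BL′Set⇒DSet {π} ((((_ , shape) , lk) , _ , chain) , weight≡n , length≡s , numOver≡j , l) =
    All⇒AllPosℕ (positions-positive w) ,
    positions-strictDec w ,
    trans (sym (weight-fromWord w)) (trans (cong weight π≡) weight≡n) ,
    trans (length-positions w) (trans (sym (numOver-fromWord w)) (trans (cong numOver π≡) numOver≡j)) ,
    All⇒AllCong k s (All.zipWith (λ (i≤ℓ , k∣ℓ∸i) → trans (∣∸⇒%≡ k i≤ℓ k∣ℓ∸i) ℓ≡s)
                      (positions-≤length w , LkCond-fromWord⁻ k w (subst (LkCond k) (sym π≡) lk)))
    where
    w : List Bool
    w = overlines π
    π≡ : fromWord w ≡ π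
    π≡ = fromWord-overlines π shape chain l
    ℓ≡s : length w % k ≡ s % k
    ℓ≡s = trans (cong (_% k) (length-map proj₂ π)) length≡s

  DSet↔BL′Set : DSet k s n j ↔ᵖ BL′Set k s n j
  DSet↔BL′Set = record
    { to        = fromWord ∘ indicator
    ; from      = positions ∘ overlines
    ; to-pres   = DSet⇒BL′Set
    ; from-pres = BL′Set⇒DSet
    ; from∘to   = λ {μ} (pos , dec , _) →
        trans (cong positions (overlines-fromWord (indicator μ))) (positions-indicator μ pos dec)
    ; to∘from   = λ {π} ((((_ , shape) , _) , _ , chain) , _ , _ , _ , l) →
        trans (cong fromWord (indicator-positions (overlines π) (last-overlines π l))) (fromWord-overlines π shape chain l)
    }

-- Moving the bar of the last part
LkCond-singleton : ∀ k p → LkCond k (p ∷ [])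
LkCond-singleton k (_ , true)  = k ∣0 , tt
LkCond-singleton k (_ , false) = tt

setLastBar : Bool → OverPtn → OverPtn
setLastBar b []             = []
setLastBar b ((t , _) ∷ []) = (t , b) ∷ []
setLastBar b (p ∷ q ∷ π)    = p ∷ setLastBar b (q ∷ π)

module _ (b : Bool) where

  AllPos-setLastBar : ∀ π → AllPos π → AllPos (setLastBar b π)
  AllPos-setLastBar []          _           = tt
  AllPos-setLastBar (_ ∷ [])    pos         = pos
  AllPos-setLastBar (_ ∷ q ∷ π) (1≤t , pos) = 1≤t , AllPos-setLastBar (q ∷ π) pos

  OverPtnShape-setLastBar : ∀ π → OverPtnShape π → OverPtnShape (setLastBar b π)
  OverPtnShape-setLastBar []                          _             = tt
  OverPtnShape-setLastBar (_ ∷ [])                    _             = tt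
  OverPtnShape-setLastBar ((_ , true)  ∷ _ ∷ [])      shape         = shape
  OverPtnShape-setLastBar ((_ , false) ∷ _ ∷ [])      shape         = shape
  OverPtnShape-setLastBar ((_ , true)  ∷ q ∷ q′ ∷ π) (u<t , shape) = u<t , OverPtnShape-setLastBar (q ∷ q′ ∷ π) shape
  OverPtnShape-setLastBar ((_ , false) ∷ q ∷ q′ ∷ π) (u≤t , shape) = u≤t , OverPtnShape-setLastBar (q ∷ q′ ∷ π) shape

  BLChain-setLastBar : ∀ π → BLChain π → BLChain (setLastBar b π)
  BLChain-setLastBar []                          _               = tt
  BLChain-setLastBar (_ ∷ [])                    _               = tt
  BLChain-setLastBar ((_ , true)  ∷ _ ∷ [])      chain           = chain
  BLChain-setLastBar ((_ , false) ∷ _ ∷ [])      chain           = chain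
  BLChain-setLastBar ((_ , true)  ∷ q ∷ q′ ∷ π) (t≤u+1 , chain) = t≤u+1 , BLChain-setLastBar (q ∷ q′ ∷ π) chain
  BLChain-setLastBar ((_ , false) ∷ q ∷ q′ ∷ π) (t<u+1 , chain) = t<u+1 , BLChain-setLastBar (q ∷ q′ ∷ π) chain

  length-setLastBar : ∀ π → length (setLastBar b π) ≡ length π
  length-setLastBar []          = refl
  length-setLastBar (_ ∷ [])    = refl
  length-setLastBar (_ ∷ q ∷ π) = cong suc (length-setLastBar (q ∷ π))

  weight-setLastBar : ∀ π → weight (setLastBar b π) ≡ weight π
  weight-setLastBar []          = refl
  weight-setLastBar (_ ∷ [])    = refl
  weight-setLastBar (p ∷ q ∷ π) = cong (size p +_) (weight-setLastBar (q ∷ π))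

  LkCond-setLastBar : ∀ k π → LkCond k π → LkCond k (setLastBar b π)
  LkCond-setLastBar k []                    _          = tt
  LkCond-setLastBar k (p ∷ [])              _          = LkCond-singleton k (size p , b)
  LkCond-setLastBar k ((_ , true)  ∷ q ∷ π) (k∣ℓ , lk) =
    subst (k ∣_) (sym (length-setLastBar (q ∷ π))) k∣ℓ , LkCond-setLastBar k (q ∷ π) lk
  LkCond-setLastBar k ((_ , false) ∷ q ∷ π) lk        = LkCond-setLastBar k (q ∷ π) lk

  LastIs-setLastBar : ∀ {t b′} π → LastIs (t , b′) π → LastIs (t , b) (setLastBar b π)
  LastIs-setLastBar (_ ∷ [])         refl = refl
  LastIs-setLastBar (_ ∷ _ ∷ [])     refl = refl
  LastIs-setLastBar (_ ∷ q ∷ q′ ∷ π) l    = LastIs-setLastBar (q ∷ q′ ∷ π) l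

  IsBL-setLastBar : ∀ k π → IsBL k π → IsBL k (setLastBar b π)
  IsBL-setLastBar k π (((pos , shape) , lk) , (_ , l) , chain) =
    ((AllPos-setLastBar π pos , OverPtnShape-setLastBar π shape) , LkCond-setLastBar k π lk) ,
    (b , LastIs-setLastBar π l) , BLChain-setLastBar π chain

setLastBar-inverse : ∀ {t b} b′ π → LastIs (t , b) π → setLastBar b (setLastBar b′ π) ≡ π
setLastBar-inverse b′ (_ ∷ [])         refl = refl
setLastBar-inverse b′ (_ ∷ _ ∷ [])     refl = refl
setLastBar-inverse b′ (p ∷ q ∷ q′ ∷ π) l    = cong (p ∷_) (setLastBar-inverse b′ (q ∷ q′ ∷ π) l)

numOver-setLastBar-false : ∀ {t} π → LastIs (t , true) π → numOver π ≡ suc (numOver (setLastBar false π))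
numOver-setLastBar-false (_ ∷ [])              refl = refl
numOver-setLastBar-false ((_ , true)  ∷ q ∷ π) l    = cong suc (numOver-setLastBar-false (q ∷ π) l)
numOver-setLastBar-false ((_ , false) ∷ q ∷ π) l    = numOver-setLastBar-false (q ∷ π) l

numOver-setLastBar-true : ∀ {t} π → LastIs (t , false) π → numOver (setLastBar true π) ≡ suc (numOver π)
numOver-setLastBar-true (_ ∷ [])              refl = refl
numOver-setLastBar-true ((_ , true)  ∷ q ∷ π) l    = cong suc (numOver-setLastBar-true (q ∷ π) l)
numOver-setLastBar-true ((_ , false) ∷ q ∷ π) l    = numOver-setLastBar-true (q ∷ π) l

module _ (k : ℕ) .{{_ : NonZero k}} (s n j : ℕ) (1≤j : 1 ≤ j) where

  BL′Set↔BL″Set : BL′Set k s n j ↔ᵖ BL″Set k s n (j ∸ 1)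
  BL′Set↔BL″Set = record
    { to        = setLastBar false
    ; from      = setLastBar true
    ; to-pres   = λ {π} (bl , weight≡n , length≡s , numOver≡j , l) →
        IsBL-setLastBar false k π bl ,
        trans (weight-setLastBar false π) weight≡n ,
        trans (cong (_% k) (length-setLastBar false π)) length≡s ,
        cong (_∸ 1) (trans (sym (numOver-setLastBar-false π l)) numOver≡j) ,
        LastIs-setLastBar false π l
    ; from-pres = λ {π} (bl , weight≡n , length≡s , numOver≡j-1 , l) →
        IsBL-setLastBar true k π bl ,
        trans (weight-setLastBar true π) weight≡n ,
        trans (cong (_% k) (length-setLastBar true π)) length≡s ,
        trans (numOver-setLastBar-true π l) (trans (cong suc numOver≡j-1) (m+[n∸m]≡n 1≤j)) ,
        LastIs-setLastBar true π l
    ; from∘to   = λ {π} (_ , _ , _ , _ , l) → setLastBar-inverse false π l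
    ; to∘from   = λ {π} (_ , _ , _ , _ , l) → setLastBar-inverse true π l
    }

proposition3p8 : (k : ℕ) → .{{_ : NonZero k}} → (s n j : ℕ) →
    1 ≤ s → s ≤ k → 1 ≤ n → 1 ≤ j →
    Σ ℕ λ c → HasCount (BL′Set k s n j) c × HasCount (BL″Set k s n (j ∸ 1)) c × HasCount (DSet k s n j) c
proposition3p8 k s n j _ _ _ 1≤j =
  count , BL′-count , HasCount-↔ᵖ (BL′Set↔BL″Set k s n j 1≤j) BL′-count , D-count
  where
  count : ℕ
  count = length (filter (DSet? k s n j) (decreasingListsUpTo n))

  D-count : HasCount (DSet k s n j) count
  D-count = DSet-count k s n j

  BL′-count : HasCount (BL′Set k s n j) count
  BL′-count = HasCount-↔ᵖ (DSet↔BL′Set k s n j 1≤j) D-count
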